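{- Let $G\in\mathscr{G}_{a,b}$, let $u,v\in V(G_0)$ with $d(u)=d(v)$, and suppose $N_{G_0}(u)=\{u',u''\}$ and $N_{G_0}(v)=\{v',v''\}$. Then $d(u')=d(v')$ if and only if $d(u'')=d(v'')$.
   Context: Graphs are finite, simple and connected; $d(v)$ denotes the degree of $v$ in $G$ and $s(v)=\sum_{u\in N_G(v)}d(u)$. A graph $G$ is 2-walk $(a,b)$-parabolic if there exist uniquely a positive integer $a$ and a non-negative integer $b$ such that $a^2-8b>0$ and $s(v)=-d(v)^2+a\,d(v)-b$ for all $v\in V(G)$. A bicyclic graph is a simple connected graph with number of edges equal to number of vertices plus one. $\mathscr{G}_{a,b}$ is the set of 2-walk $(a,b)$-parabolic bicyclic graphs $G$ with minimum degree $\delta(G)=1$. For $G\in\mathscr{G}_{a,b}$, $G_0$ is the graph obtained from $G$ by deleting all pendant (degree-1) vertices, $N_{G_0}(v)$ is the neighbourhood of $v$ in $G_0$ and $d_{G_0}(v)$ its degree in $G_0$. -}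

module Defs where

open import Data.Nat using (ℕ; zero; suc; _+_; _*_; _<_; _≤_)
open import Data.Integer as ℤ using (ℤ; +_)
open import Data.Bool using (Bool; true; false; T; not)
open import Data.Fin using (Fin; _<?_)
open import Data.List using (List; length; filter; map; allFin; concatMap)
open import Data.Nat.ListAction using (sum)
open import Data.Product using (Σ; _×_; _,_; ∃)
open import Data.Sum using (_⊎_)
open import Relation.Nullary using (¬_)
open import Relation.Nullary.Decidable using (⌊_⌋)
open import Relation.Binary.PropositionalEquality using (_≡_)
open import Function.Bundles using (_⇔_)

record Graph : Set where
  field
    n     : ℕ
    adj   : Fin n → Fin n → Bool
    sym   : ∀ x y → adj x y ≡ adj y x
    irrefl : ∀ x → adj x x ≡ false
open Graph public

Adj : (G : Graph) → Fin (n G) → Fin (n G) → Set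
Adj G x y = T (adj G x y)

nbrs : (G : Graph) → Fin (n G) → List (Fin (n G))
nbrs G v = filter (λ w → T? (adj G v w)) (allFin (n G))
  where
  open import Data.Bool.Properties using (T?)

deg : (G : Graph) → Fin (n G) → ℕ
deg G v = length (nbrs G v)

s : (G : Graph) → Fin (n G) → ℕ
s G v = sum (map (deg G) (nbrs G v))

data Walk (G : Graph) : Fin (n G) → Fin (n G) → Set where
  [] : ∀ {x} → Walk G x x
  _∷_ : ∀ {x y z} → Adj G x y → Walk G y z → Walk G x z

Connected : Graph → Set
Connected G = ∀ x y → Walk G x y

edgeCount : Graph → ℕ
edgeCount G =
  length (filter (λ p → T? (adj G (Data.Product.proj₁ p) (Data.Product.proj₂ p)))
           (concatMap (λ i → map (λ j → (i , j))
                                 (filter (λ j → i <? j) (allFin (n G))))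
                      (allFin (n G))))
  where
  open import Data.Bool.Properties using (T?)
  import Data.Product

Bicyclic : Graph → Set
Bicyclic G = Connected G × (edgeCount G ≡ n G + 1)

ParabolicPair : Graph → ℕ → ℕ → Set
ParabolicPair G a b =
  (1 ≤ a) × (8 * b < a * a) ×
  (∀ v → + (s G v) ≡ (ℤ.- (+ deg G v ℤ.* + deg G v)) ℤ.+ (+ a ℤ.* + deg G v) ℤ.- + b)

TwoWalkParabolic : Graph → ℕ → ℕ → Set
TwoWalkParabolic G a b =
  ParabolicPair G a b × (∀ a' b' → ParabolicPair G a' b' → (a' ≡ a) × (b' ≡ b))

MinDegOne : Graph → Set
MinDegOne G = (∀ v → 1 ≤ deg G v) × (∃ λ v → deg G v ≡ 1)

InGab : ℕ → ℕ → Graph → Set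
InGab a b G = TwoWalkParabolic G a b × Bicyclic G × MinDegOne G

-- V(G₀): vertices of G that are not pendant.
InG0 : (G : Graph) → Fin (n G) → Set
InG0 G v = ¬ (deg G v ≡ 1)

NbrsG0Are : (G : Graph) → Fin (n G) → Fin (n G) → Fin (n G) → Set
NbrsG0Are G v x y =
  ¬ (x ≡ y) × (∀ w → (Adj G v w × InG0 G w) ⇔ ((w ≡ x) ⊎ (w ≡ y)))

module Submission where

-- Let u be a vertex of G₀ with N_{G₀}(u) = {u′, u″}.  Every other
-- neighbour of u is pendant and contributes 1 to s(u), and there are d(u) − 2
-- of them, so
--          s(u) + 2 = d(u′) + d(u″) + d(u).                       (★)
-- The parabolic condition makes s(u) a function of d(u), so d(u) = d(v)
-- forces s(u) = s(v); by (★) for u and v, d(u′) + d(u″) = d(v′) + d(v″),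
-- and the equivalence follows by cancellation.

open import Defs hiding (sym)
open import Data.Nat using (ℕ; suc; _+_; _≟_)
open import Data.Nat.Properties using (+-suc; +-assoc; +-identityʳ; +-cancelˡ-≡; +-cancelʳ-≡)
open import Data.Nat.ListAction using (sum)
open import Data.Nat.ListAction.Properties using (sum-↭)
import Data.Integer as ℤ
open import Data.Integer.Properties using (+-injective)
open import Data.Fin using (Fin)
open import Data.List using (List; []; _∷_; length; filter; map; allFin)
open import Data.List.Properties using (filter-accept; filter-reject)
open import Data.List.Membership.Propositional using (_∈_)
open import Data.List.Membership.Propositional.Properties using (∈-filter⁺; ∈-filter⁻; ∈-allFin)
open import Data.List.Membership.Propositional.Properties.WithK using (unique∧set⇒bag)
open import Data.List.Relation.Unary.Any using (here; there)
open import Data.List.Relation.Unary.All using ([]; _∷_)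
open import Data.List.Relation.Unary.AllPairs using ([]; _∷_)
open import Data.List.Relation.Unary.Unique.Propositional using (Unique)
import Data.List.Relation.Unary.Unique.Propositional.Properties as Unique
open import Data.List.Relation.Binary.Permutation.Propositional using (_↭_)
open import Data.List.Relation.Binary.Permutation.Propositional.Properties using (↭-length; map⁺)
open import Data.List.Relation.Binary.BagAndSetEquality using (∼bag⇒↭)
open import Data.Bool.Properties using (T?)
open import Data.Product using (_,_; proj₂)
open import Data.Sum using (_⊎_; inj₁; inj₂)
open import Relation.Nullary using (¬_; Dec; yes; no; ¬?)
open import Relation.Binary.PropositionalEquality using (_≡_; refl; sym; trans; cong; module ≡-Reasoning)
open import Function.Bundles using (_⇔_; mk⇔; Equivalence)

sum-cancel-⇔ : ∀ {a b c d : ℕ} → a + b ≡ c + d → (a ≡ c) ⇔ (b ≡ d)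
sum-cancel-⇔ {a} {b} {c} {d} eq =
  mk⇔ (λ { refl → +-cancelˡ-≡ a b d eq })
      (λ { refl → +-cancelʳ-≡ b a c eq })

module _ {A : Set} (f : A → ℕ) where

  nonOne : List A → List A
  nonOne = filter (λ w → ¬? (f w ≟ 1))

  -- Entries with f-value 1 add 1 to the sum and 1 to the length, so removing
  -- them from the sum on one side and from the length on the other balances.
  sum+nonOnes≡nonOneSum+length : (L : List A) →
    sum (map f L) + length (nonOne L) ≡ sum (map f (nonOne L)) + length L
  sum+nonOnes≡nonOneSum+length [] = refl
  sum+nonOnes≡nonOneSum+length (w ∷ L) with f w ≟ 1
  ... | yes fw≡1
    rewrite filter-reject (λ w → ¬? (f w ≟ 1)) {w} {L} (λ fw≢1 → fw≢1 fw≡1) | fw≡1 =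
      trans (cong suc (sum+nonOnes≡nonOneSum+length L)) (sym (+-suc _ _))
  ... | no fw≢1 rewrite filter-accept (λ w → ¬? (f w ≟ 1)) {w} {L} fw≢1 = begin
      (f w + sum (map f L)) + suc (length (nonOne L))
        ≡⟨ +-assoc (f w) _ _ ⟩
      f w + (sum (map f L) + suc (length (nonOne L)))
        ≡⟨ cong (f w +_) (+-suc _ _) ⟩
      f w + suc (sum (map f L) + length (nonOne L))
        ≡⟨ cong (λ k → f w + suc k) (sum+nonOnes≡nonOneSum+length L) ⟩
      f w + suc (sum (map f (nonOne L)) + length L)
        ≡⟨ cong (f w +_) (sym (+-suc _ _)) ⟩
      f w + (sum (map f (nonOne L)) + suc (length L))
        ≡⟨ sym (+-assoc (f w) _ _) ⟩
      (f w + sum (map f (nonOne L))) + suc (length L) ∎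
    where open ≡-Reasoning

twoElements↭ : ∀ {A : Set} {x y : A} {K : List A} → Unique K → ¬ x ≡ y →
  (∀ w → w ∈ K ⇔ ((w ≡ x) ⊎ (w ≡ y))) → K ↭ (x ∷ y ∷ [])
twoElements↭ {x = x} {y} uniqueK x≢y members =
  ∼bag⇒↭ (unique∧set⇒bag uniqueK ((x≢y ∷ []) ∷ [] ∷ [])
           (λ {w} → mk⇔ (λ w∈K → pair⁺ (to (members w) w∈K))
                        (λ w∈xy → from (members w) (pair⁻ w∈xy))))
  where
  open Equivalence
  pair⁺ : ∀ {w} → (w ≡ x) ⊎ (w ≡ y) → w ∈ x ∷ y ∷ []
  pair⁺ (inj₁ w≡x) = here w≡x
  pair⁺ (inj₂ w≡y) = there (here w≡y)
  pair⁻ : ∀ {w} → w ∈ x ∷ y ∷ [] → (w ≡ x) ⊎ (w ≡ y)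
  pair⁻ (here w≡x)         = inj₁ w≡x
  pair⁻ (there (here w≡y)) = inj₂ w≡y

-- (★): if N_{G₀}(u) = {x , y}, then s(u) + 2 = d(x) + d(y) + d(u), because
-- the G₀-neighbours of u form a permutation of [x , y] and all other
-- neighbours are pendant.
degreeSum : (G : Graph) (u x y : Fin (n G)) → NbrsG0Are G u x y →
  s G u + 2 ≡ (deg G x + deg G y) + deg G u
degreeSum G u x y (x≢y , members) = begin
  s G u + 2                                    ≡⟨ cong (s G u +_) (sym (↭-length nbrsG0↭xy)) ⟩
  s G u + length (nonOne (deg G) (nbrs G u))    ≡⟨ sum+nonOnes≡nonOneSum+length (deg G) (nbrs G u) ⟩
  sum (map (deg G) (nonOne (deg G) (nbrs G u))) + deg G u
                                               ≡⟨ cong (_+ deg G u) (sum-↭ (map⁺ (deg G) nbrsG0↭xy)) ⟩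
  (deg G x + (deg G y + 0)) + deg G u          ≡⟨ cong (λ k → (deg G x + k) + deg G u) (+-identityʳ (deg G y)) ⟩
  (deg G x + deg G y) + deg G u                ∎
  where
  open ≡-Reasoning
  open Equivalence
  isNbr : (w : Fin (n G)) → Dec (Adj G u w)
  isNbr w = T? (adj G u w)
  isNonPendant : (w : Fin (n G)) → Dec (InG0 G w)
  isNonPendant w = ¬? (deg G w ≟ 1)

  nbrsG0↭xy : nonOne (deg G) (nbrs G u) ↭ (x ∷ y ∷ [])
  nbrsG0↭xy = twoElements↭
    (Unique.filter⁺ isNonPendant (Unique.filter⁺ isNbr (Unique.allFin⁺ (n G))))
    x≢y
    (λ w → mk⇔
      (λ w∈ → let (w∈N , nonPendant) = ∈-filter⁻ isNonPendant w∈ in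
              to (members w) (proj₂ (∈-filter⁻ isNbr {xs = allFin (n G)} w∈N) , nonPendant))
      (λ w≡ → let (adjacent , nonPendant) = from (members w) w≡ in
              ∈-filter⁺ isNonPendant (∈-filter⁺ isNbr (∈-allFin w) adjacent) nonPendant))

s-determined-by-deg : ∀ {a b} (G : Graph) → ParabolicPair G a b →
  ∀ u v → deg G u ≡ deg G v → s G u ≡ s G v
s-determined-by-deg {a} {b} G (_ , _ , parabolic) u v du≡dv =
  +-injective (trans (parabolic u) (trans (cong quadratic du≡dv) (sym (parabolic v))))
  where
  quadratic : ℕ → ℤ.ℤ
  quadratic d = (ℤ.- (ℤ.+ d ℤ.* ℤ.+ d)) ℤ.+ (ℤ.+ a ℤ.* ℤ.+ d) ℤ.- ℤ.+ b

lemma7 : (a b : ℕ) (G : Graph) → InGab a b G →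
    (u v u′ u″ v′ v″ : Fin (n G)) →
    InG0 G u → InG0 G v → deg G u ≡ deg G v →
    NbrsG0Are G u u′ u″ → NbrsG0Are G v v′ v″ →
    (deg G u′ ≡ deg G v′) ⇔ (deg G u″ ≡ deg G v″)
lemma7 a b G ((parabolic , _) , _) u v u′ u″ v′ v″ _ _ du≡dv Nu Nv =
  sum-cancel-⇔ (+-cancelʳ-≡ (deg G u) _ _ (begin
    (deg G u′ + deg G u″) + deg G u ≡⟨ sym (degreeSum G u u′ u″ Nu) ⟩
    s G u + 2                       ≡⟨ cong (_+ 2) (s-determined-by-deg G parabolic u v du≡dv) ⟩
    s G v + 2                       ≡⟨ degreeSum G v v′ v″ Nv ⟩
    (deg G v′ + deg G v″) + deg G v ≡⟨ cong ((deg G v′ + deg G v″) +_) (sym du≡dv) ⟩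
    (deg G v′ + deg G v″) + deg G u ∎))
  where open ≡-Reasoning
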